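{- Let $w$ be a rich word. Then there exist pairwise distinct non-empty palindromes $w_1,w_2,\dots,w_p$ such that $w=w_pw_{p-1}\cdots w_2w_1$ and, for each $i=1,2,\dots,p$, the word $w_i$ is the longest palindromic suffix of $w_pw_{p-1}\cdots w_i$.
   Context: A finite word $u=u_1\cdots u_n$ is a palindrome if $u_1u_2\cdots u_n=u_nu_{n-1}\cdots u_1$; the empty word is a palindrome and a factor of every word. A word $w$ of length $n$ is called rich if it has exactly $n+1$ distinct palindromic factors (including the empty word). -}

module Defs where

open import Data.List using (List; []; _∷_; _++_; reverse; length; concat)
open import Data.List.Relation.Unary.All using (All)
open import Data.List.Relation.Unary.Unique.Propositional using (Unique)
open import Data.List.Membership.Propositional using (_∈_)
open import Data.Nat using (ℕ; suc; _≤_)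
open import Data.Product using (Σ; ∃; ∃-syntax; _×_)
open import Relation.Binary.PropositionalEquality using (_≡_; _≢_)

IsPalindrome : ∀ {a} {A : Set a} → List A → Set a
IsPalindrome u = u ≡ reverse u

IsFactor : ∀ {a} {A : Set a} → List A → List A → Set a
IsFactor u w = ∃[ x ] ∃[ y ] (w ≡ x ++ u ++ y)

IsSuffix : ∀ {a} {A : Set a} → List A → List A → Set a
IsSuffix u w = ∃[ x ] (w ≡ x ++ u)

PalFactor : ∀ {a} {A : Set a} → List A → List A → Set a
PalFactor w u = IsFactor u w × IsPalindrome u

-- w (of length n) is rich iff it has exactly n+1 distinct palindromic
-- factors (the empty word included): there is a duplicate-free list of
-- length n+1 whose members are exactly the palindromic factors of w.
Rich : ∀ {a} {A : Set a} → List A → Set a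
Rich w = ∃[ ps ] (Unique ps
                 × All (PalFactor w) ps
                 × (∀ u → PalFactor w u → u ∈ ps)
                 × length ps ≡ suc (length w))

IsLongestPalSuffix : ∀ {a} {A : Set a} → List A → List A → Set a
IsLongestPalSuffix u w =
  IsSuffix u w × IsPalindrome u
  × (∀ v → IsSuffix v w → IsPalindrome v → length v ≤ length u)

NonEmpty : ∀ {a} {A : Set a} → List A → Set a
NonEmpty u = u ≢ []

-- The list ws = w₁ ∷ w₂ ∷ … ∷ wₚ (index order) satisfies: for each i,
-- wᵢ is the longest palindromic suffix of wₚ wₚ₋₁ ⋯ wᵢ,
-- i.e. of concat (reverse (wᵢ ∷ wᵢ₊₁ ∷ … ∷ wₚ)).
data LPSChain {a} {A : Set a} : List (List A) → Set a where
  []  : LPSChain []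
  _∷_ : ∀ {u us} → IsLongestPalSuffix u (concat (reverse (u ∷ us)))
        → LPSChain us → LPSChain (u ∷ us)

-- Adding a letter to a word creates at most one new palindrome, namely its longest
-- palindromic suffix: any shorter palindromic suffix is also a prefix of that
-- palindrome, so it already occurs earlier. Hence a word of length n has at most
-- n + 1 palindromic factors, and in a rich word w every prefix is rich and the
-- longest palindromic suffix u of w does not occur in the rest of w (otherwise w
-- would have too few palindromes). Writing w = x u, peeling u off and recursing on
-- the rich word x yields the factorisation; the pieces are distinct because u is
-- not a factor of x, which contains all the later pieces.
--
-- The palindromes of w can only be enumerated over an alphabet with decidable
-- equality. A rich word provides one: its letters are the singletons in the
-- duplicate-free list of its palindromes, compared by their positions there.
module Submission where

open import Defs
open import Data.Fin.Properties using () renaming (_≟_ to _≟ᶠ_)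
open import Data.List
  using (List; []; _∷_; _++_; [_]; _∷ʳ_; reverse; length; concat; map; filter; lookup;
         initLast; _∷ʳ′_)
open import Data.List.Properties
  using (∷-injective; ∷-injectiveˡ; ∷-injectiveʳ; ∷ʳ-injectiveˡ; ++-assoc; ++-identityʳ;
         length-++; unfold-reverse; reverse-++; reverse-map; map-++; length-map;
         length-++-≤ˡ; length-++-≤ʳ; map-injective; concat-++; concat-map; ≡-dec; filter-all)
open import Data.List.Reverse using (Reverse; []; _∶_∶ʳ_; reverseView)
open import Data.List.Relation.Unary.All as All using (All; []; _∷_)
open import Data.List.Relation.Unary.All.Properties using (all-filter; filter⁺)
import Data.List.Relation.Unary.All.Properties as All
open import Data.List.Relation.Unary.AllPairs using ([]; _∷_)
open import Data.List.Relation.Unary.Any using (index)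
open import Data.List.Relation.Unary.Any.Properties using (lookup-index)
open import Data.List.Relation.Unary.Unique.Propositional using (Unique)
import Data.List.Relation.Unary.Unique.Propositional.Properties as Unique
open import Data.List.Membership.Propositional using (_∈_)
open import Data.List.Membership.Propositional.Properties using (∈-∃++)
open import Data.List.Membership.Propositional.Properties.WithK using (unique⇒irrelevant)
open import Data.Nat using (suc; _≤_; _<_; z≤n; s≤s)
open import Data.Nat.Induction using (<-wellFounded)
open import Data.Nat.Properties
  using (≤-reflexive; ≤-trans; ≤-pred; <⇒≱; <-irrefl; <-cmp; m≤n⇒m<n∨m≡n; m≢1+n+m; +-comm)
open import Data.Product using (Σ; ∃-syntax; _×_; _,_; proj₁; proj₂)
open import Data.Sum using (_⊎_; inj₁; inj₂)
open import Data.Empty using (⊥-elim)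
open import Function.Definitions using (Injective)
open import Induction.WellFounded using (Acc; acc)
open import Relation.Binary.Definitions using (tri<; tri≈; tri>; DecidableEquality)
open import Relation.Binary.PropositionalEquality
  using (_≡_; _≢_; refl; sym; trans; cong; subst; subst₂; module ≡-Reasoning)
open import Relation.Nullary using (¬_; Dec; yes; no)
open import Relation.Nullary.Decidable using (decidable-stable)

module _ {a} {A : Set a} where

  ++-split : ∀ (x s y t : List A) → x ++ s ≡ y ++ t →
             ∃[ r ] (x ≡ y ++ r × t ≡ r ++ s) ⊎ ∃[ r ] (y ≡ x ++ r × s ≡ r ++ t)
  ++-split []      s y       t eq = inj₂ (y , refl , eq)
  ++-split (b ∷ x) s []      t eq = inj₁ (b ∷ x , refl , sym eq)
  ++-split (b ∷ x) s (c ∷ y) t eq with refl , eq′ ← ∷-injective eq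
    with ++-split x s y t eq′
  ... | inj₁ (r , x≡y++r , t≡r++s) = inj₁ (r , cong (b ∷_) x≡y++r , t≡r++s)
  ... | inj₂ (r , y≡x++r , s≡r++t) = inj₂ (r , cong (b ∷_) y≡x++r , s≡r++t)

  length-∷ʳ : ∀ (v : List A) b → length (v ∷ʳ b) ≡ suc (length v)
  length-∷ʳ v b = trans (length-++ v) (+-comm (length v) 1)

  concat-reverse-∷ : ∀ (u : List A) us → concat (reverse (u ∷ us)) ≡ concat (reverse us) ++ u
  concat-reverse-∷ u us = begin
    concat (reverse (u ∷ us))          ≡⟨ cong concat (unfold-reverse u us) ⟩
    concat (reverse us ∷ʳ u)           ≡⟨ concat-++ (reverse us) [ u ] ⟨
    concat (reverse us) ++ (u ++ [])   ≡⟨ cong (concat (reverse us) ++_) (++-identityʳ u) ⟩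
    concat (reverse us) ++ u           ∎
    where open ≡-Reasoning

  suffix-≡ : ∀ {w s t : List A} → IsSuffix s w → IsSuffix t w → length s ≡ length t → s ≡ t
  suffix-≡ {s = s} {t} (x , w≡x++s) (y , w≡y++t) |s|≡|t|
    with ++-split x s y t (trans (sym w≡x++s) w≡y++t)
  ... | inj₁ ([] , _ , t≡s)     = sym t≡s
  ... | inj₂ ([] , _ , s≡t)     = s≡t
  ... | inj₁ (c ∷ r , _ , t≡cr++s) =
    ⊥-elim (m≢1+n+m (length s) (trans |s|≡|t| (trans (cong length t≡cr++s) (cong suc (length-++ r)))))
  ... | inj₂ (c ∷ r , _ , s≡cr++t) =
    ⊥-elim (m≢1+n+m (length t) (trans (sym |s|≡|t|) (trans (cong length s≡cr++t) (cong suc (length-++ r)))))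

  factor-++ʳ : ∀ {q x : List A} y → IsFactor q x → IsFactor q (x ++ y)
  factor-++ʳ {q} y (p , s , x≡p++q++s) =
    p , s ++ y , trans (cong (_++ y) x≡p++q++s)
                       (trans (++-assoc p (q ++ s) y) (cong (p ++_) (++-assoc q s y)))

  suffix-factor : ∀ x (u : List A) → IsFactor u (x ++ u)
  suffix-factor x u = x , [] , cong (x ++_) (sym (++-identityʳ u))

  []-factor : ∀ {q : List A} → IsFactor q [] → q ≡ []
  []-factor {[]}    _              = refl
  []-factor {_ ∷ _} ([] , _ , ())
  []-factor {_ ∷ _} (_ ∷ _ , _ , ())

  pieces-are-factors : ∀ (us : List (List A)) → All (λ u → IsFactor u (concat (reverse us))) us
  pieces-are-factors []       = []
  pieces-are-factors (u ∷ us) =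
    subst (λ w → All (λ q → IsFactor q w) (u ∷ us)) (sym (concat-reverse-∷ u us))
          (suffix-factor (concat (reverse us)) u ∷ All.map (factor-++ʳ u) (pieces-are-factors us))

  prefix-of-init : ∀ x {y v : List A} {b} → NonEmpty y → x ++ y ≡ v ∷ʳ b → ∃[ z ] (v ≡ x ++ z)
  prefix-of-init x {y} y≢[] x++y≡v∷ʳb with initLast y
  ... | []       = ⊥-elim (y≢[] refl)
  ... | z ∷ʳ′ c  = z , ∷ʳ-injectiveˡ _ (x ++ z) (trans (sym x++y≡v∷ʳb) (sym (++-assoc x z [ c ])))

  factor-of-init : ∀ x q {y v : List A} {b} → NonEmpty y → x ++ q ++ y ≡ v ∷ʳ b → IsFactor q v
  factor-of-init x q {y} y≢[] eq with prefix-of-init (x ++ q) y≢[] (trans (++-assoc x q y) eq)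
  ... | z , v≡xq++z = x , z , trans v≡xq++z (++-assoc x q z)

  factor-of-∷ʳ : ∀ {q v : List A} {b} → IsFactor q (v ∷ʳ b) → IsFactor q v ⊎ IsSuffix q (v ∷ʳ b)
  factor-of-∷ʳ {q} (x , []    , e) = inj₂ (x , trans e (cong (x ++_) (++-identityʳ q)))
  factor-of-∷ʳ {q} (x , c ∷ y , e) = inj₁ (factor-of-init x q (λ ()) (sym e))

  palindrome-suffix-is-prefix : ∀ {s t r : List A} → IsPalindrome s → IsPalindrome t →
                                t ≡ r ++ s → t ≡ s ++ reverse r
  palindrome-suffix-is-prefix {s} {t} {r} s-pal t-pal t≡r++s = begin
    t                         ≡⟨ t-pal ⟩
    reverse t                 ≡⟨ cong reverse t≡r++s ⟩
    reverse (r ++ s)          ≡⟨ reverse-++ r s ⟩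
    reverse s ++ reverse r    ≡⟨ cong (_++ reverse r) s-pal ⟨
    s ++ reverse r            ∎
    where open ≡-Reasoning

  -- The shorter suffix s reappears as a prefix of t, hence strictly before the last letter.
  shorter-palSuffix-factor-of-init : ∀ {s t v : List A} {b} →
                                     IsSuffix s (v ∷ʳ b) → IsSuffix t (v ∷ʳ b) →
                                     IsPalindrome s → IsPalindrome t → length s < length t →
                                     IsFactor s v
  shorter-palSuffix-factor-of-init {s} {t} (x , ex) (y , ey) s-pal t-pal |s|<|t|
    with ++-split x s y t (trans (sym ex) ey)
  ... | inj₂ (r , _ , s≡r++t) =
    ⊥-elim (<⇒≱ |s|<|t| (subst (λ z → length t ≤ length z) (sym s≡r++t) (length-++-≤ʳ t {r})))
  ... | inj₁ (r , _ , t≡r++s) =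
    factor-of-init y s reverse-r≢[] (trans (cong (y ++_) (sym t≡s++r′)) (sym ey))
    where
    t≡s++r′ : t ≡ s ++ reverse r
    t≡s++r′ = palindrome-suffix-is-prefix s-pal t-pal t≡r++s
    reverse-r≢[] : NonEmpty (reverse r)
    reverse-r≢[] r′≡[] =
      <-irrefl (sym (cong length (trans t≡s++r′ (trans (cong (s ++_) r′≡[]) (++-identityʳ s))))) |s|<|t|

  new-palindrome-is-suffix : ∀ {s v : List A} {b} → PalFactor (v ∷ʳ b) s → ¬ IsFactor s v →
                             IsSuffix s (v ∷ʳ b)
  new-palindrome-is-suffix (s-fac , _) s∉v with factor-of-∷ʳ s-fac
  ... | inj₁ s∈v   = ⊥-elim (s∉v s∈v)
  ... | inj₂ s-suf = s-suf

  new-palindrome-unique : ∀ {s t v : List A} {b} →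
                          PalFactor (v ∷ʳ b) s → ¬ IsFactor s v →
                          PalFactor (v ∷ʳ b) t → ¬ IsFactor t v → s ≡ t
  new-palindrome-unique {s} {t} ps@(_ , s-pal) s∉v pt@(_ , t-pal) t∉v
    with s-suf ← new-palindrome-is-suffix ps s∉v | t-suf ← new-palindrome-is-suffix pt t∉v
    with <-cmp (length s) (length t)
  ... | tri< |s|<|t| _ _ = ⊥-elim (s∉v (shorter-palSuffix-factor-of-init s-suf t-suf s-pal t-pal |s|<|t|))
  ... | tri≈ _ |s|≡|t| _ = suffix-≡ s-suf t-suf |s|≡|t|
  ... | tri> _ _ |t|<|s| = ⊥-elim (t∉v (shorter-palSuffix-factor-of-init t-suf s-suf t-pal s-pal |t|<|s|))

  palFactor-of-∷ʳ : ∀ {u q v : List A} {b} → IsLongestPalSuffix u (v ∷ʳ b) → IsFactor u v →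
                    PalFactor (v ∷ʳ b) q → IsFactor q v
  palFactor-of-∷ʳ {u} {q} {v} (u-suf , u-pal , u-max) u∈v (q-fac , q-pal) with factor-of-∷ʳ q-fac
  ... | inj₁ q∈v   = q∈v
  ... | inj₂ q-suf with m≤n⇒m<n∨m≡n (u-max q q-suf q-pal)
  ...   | inj₁ |q|<|u| = shorter-palSuffix-factor-of-init q-suf u-suf q-pal u-pal |q|<|u|
  ...   | inj₂ |q|≡|u| = subst (λ t → IsFactor t v) (sym (suffix-≡ q-suf u-suf |q|≡|u|)) u∈v

  AtLeastRich : List A → Set a
  AtLeastRich w = ∃[ qs ] (Unique qs × All (PalFactor w) qs × suc (length w) ≤ length qs)

  LPSFactorisation : List A → Set a
  LPSFactorisation w = ∃[ ws ] (Unique ws × All NonEmpty ws × All IsPalindrome ws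
                               × w ≡ concat (reverse ws) × LPSChain ws)

  lpsFactorisation-++ : ∀ {x u} → LPSFactorisation x → NonEmpty u → ¬ IsFactor u x →
                        IsLongestPalSuffix u (x ++ u) → LPSFactorisation (x ++ u)
  lpsFactorisation-++ {u = u} (ws , ws-unique , ws-nonEmpty , ws-pal , refl , chain) u≢[] u∉x u-lps =
    u ∷ ws , All.map u≢factor (pieces-are-factors ws) ∷ ws-unique , u≢[] ∷ ws-nonEmpty ,
    proj₁ (proj₂ u-lps) ∷ ws-pal , sym (concat-reverse-∷ u ws) ,
    subst (IsLongestPalSuffix u) (sym (concat-reverse-∷ u ws)) u-lps ∷ chain
    where
    u≢factor : ∀ {q} → IsFactor q (concat (reverse ws)) → u ≢ q
    u≢factor q∈x refl = u∉x q∈x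

module _ {a} {A : Set a} (_≟_ : DecidableEquality A) where

  isPrefix? : ∀ (q v : List A) → Dec (∃[ y ] (v ≡ q ++ y))
  isPrefix? []      v       = yes (v , refl)
  isPrefix? (b ∷ q) []      = no λ ()
  isPrefix? (b ∷ q) (c ∷ v) with b ≟ c | isPrefix? q v
  ... | yes refl | yes (y , v≡q++y) = yes (y , cong (b ∷_) v≡q++y)
  ... | yes refl | no  q∉v          = no λ (y , e) → q∉v (y , ∷-injectiveʳ e)
  ... | no  b≢c  | _                = no λ (y , e) → b≢c (sym (∷-injectiveˡ e))

  isFactor? : ∀ (q v : List A) → Dec (IsFactor q v)
  isFactor? q []      with isPrefix? q []
  ... | yes (y , e) = yes ([] , y , e)
  ... | no  q∉[]    = no λ { ([] , y , e) → q∉[] (y , e) ; (_ ∷ _ , _ , ()) }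
  isFactor? q (c ∷ v) with isPrefix? q (c ∷ v) | isFactor? q v
  ... | yes (y , e)      | _                = yes ([] , y , e)
  ... | no  _            | yes (x , y , e)  = yes (c ∷ x , y , cong (c ∷_) e)
  ... | no  q∉prefix     | no  q∉v          =
    no λ { ([] , y , e) → q∉prefix (y , e) ; (_ ∷ x , y , e) → q∉v (x , y , ∷-injectiveʳ e) }

  isPalindrome? : ∀ (u : List A) → Dec (IsPalindrome u)
  isPalindrome? u = ≡-dec _≟_ u (reverse u)

  length-filter-factors : ∀ {v b} qs → Unique qs → All (PalFactor (v ∷ʳ b)) qs →
                          length qs ≤ suc (length (filter (λ q → isFactor? q v) qs))
  length-filter-factors         []       _                 _          = z≤n
  length-filter-factors {v} (q ∷ qs) (q∉qs ∷ qs-unique) (pq ∷ pqs) with isFactor? q v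
  ... | yes _   = s≤s (length-filter-factors qs qs-unique pqs)
  ... | no  q∉v = s≤s (≤-reflexive (cong length (sym (filter-all (λ t → isFactor? t v) old))))
    where
    old : All (λ t → IsFactor t v) qs
    old = All.zipWith (λ (q≢t , pt) → decidable-stable (isFactor? _ v)
                                        (λ t∉v → q≢t (new-palindrome-unique pq q∉v pt t∉v)))
                      (q∉qs , pqs)

  palFactors-∷ʳ⁻ : ∀ {v b} qs → Unique qs → All (PalFactor (v ∷ʳ b)) qs →
                   ∃[ rs ] (Unique rs × All (PalFactor v) rs × length qs ≤ suc (length rs))
  palFactors-∷ʳ⁻ {v} qs qs-unique pqs =
    filter factor? qs , Unique.filter⁺ factor? qs-unique ,
    All.zipWith (λ (fq , pq) → fq , proj₂ pq) (all-filter factor? qs , filter⁺ factor? pqs) ,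
    length-filter-factors qs qs-unique pqs
    where
    factor? : ∀ q → Dec (IsFactor q v)
    factor? q = isFactor? q v

  palFactors-bound : ∀ {w} → Reverse w → ∀ qs → Unique qs → All (PalFactor w) qs →
                     length qs ≤ suc (length w)
  palFactors-bound [] [] _ _ = z≤n
  palFactors-bound [] (_ ∷ []) _ _ = s≤s z≤n
  palFactors-bound [] (_ ∷ _ ∷ _) ((q≢q′ ∷ _) ∷ _) ((q-fac , _) ∷ (q′-fac , _) ∷ _) =
    ⊥-elim (q≢q′ (trans ([]-factor q-fac) (sym ([]-factor q′-fac))))
  palFactors-bound (v ∶ v-view ∶ʳ b) qs qs-unique pqs with palFactors-∷ʳ⁻ qs qs-unique pqs
  ... | rs , rs-unique , prs , |qs|≤1+|rs| =
    subst (λ n → length qs ≤ suc n) (sym (length-∷ʳ v b))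
          (≤-trans |qs|≤1+|rs| (s≤s (palFactors-bound v-view rs rs-unique prs)))

  atLeastRich-∷ʳ⁻ : ∀ {v b} → AtLeastRich (v ∷ʳ b) → AtLeastRich v
  atLeastRich-∷ʳ⁻ {v} {b} (qs , qs-unique , pqs , rich) with palFactors-∷ʳ⁻ qs qs-unique pqs
  ... | rs , rs-unique , prs , |qs|≤1+|rs| =
    rs , rs-unique , prs , ≤-pred (≤-trans (subst (λ n → suc n ≤ length qs) (length-∷ʳ v b) rich) |qs|≤1+|rs|)

  atLeastRich-++⁻ : ∀ x y → AtLeastRich (x ++ y) → AtLeastRich x
  atLeastRich-++⁻ x []      rich = subst AtLeastRich (++-identityʳ x) rich
  atLeastRich-++⁻ x (b ∷ y) rich =
    atLeastRich-∷ʳ⁻ (atLeastRich-++⁻ (x ∷ʳ b) y (subst AtLeastRich (sym (++-assoc x [ b ] y)) rich))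

  lps-unioccurrent : ∀ {u v b} → AtLeastRich (v ∷ʳ b) → IsLongestPalSuffix u (v ∷ʳ b) →
                     ¬ IsFactor u v
  lps-unioccurrent {v = v} {b} (qs , qs-unique , pqs , rich) u-lps u∈v =
    <⇒≱ (subst (λ n → suc n ≤ length qs) (length-∷ʳ v b) rich)
        (palFactors-bound (reverseView v) qs qs-unique
          (All.map (λ pq → palFactor-of-∷ʳ u-lps u∈v pq , proj₂ pq) pqs))

  longestPalSuffix : ∀ w → ∃[ u ] IsLongestPalSuffix u w
  longestPalSuffix []      = [] , ([] , refl) , refl , λ { _ ([] , refl) _ → z≤n ; _ (_ ∷ _ , ()) _ }
  longestPalSuffix (b ∷ w) with isPalindrome? (b ∷ w)
  ... | yes bw-pal = b ∷ w , ([] , refl) , bw-pal , λ v (x , e) _ →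
    subst (λ z → length v ≤ length z) (sym e) (length-++-≤ʳ v {x})
  ... | no bw-nonPal with longestPalSuffix w
  ...   | u , (x , w≡x++u) , u-pal , u-max = u , (b ∷ x , cong (b ∷_) w≡x++u) , u-pal , λ
    { v ([] , refl)     v-pal → ⊥-elim (bw-nonPal v-pal)
    ; v (_ ∷ x′ , e) v-pal → u-max v (x′ , ∷-injectiveʳ e) v-pal }

  lpsFactorisation : ∀ w → AtLeastRich w → LPSFactorisation w
  lpsFactorisation w = go w (<-wellFounded (length w))
    where
    go : ∀ w → Acc _<_ (length w) → AtLeastRich w → LPSFactorisation w
    go w (acc smaller) rich with initLast w
    ... | []     = [] , [] , [] , [] , refl , []
    ... | v ∷ʳ′ b with longestPalSuffix (v ∷ʳ b)
    ...   | u , (x , w≡x++u) , u-pal , u-max =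
      subst LPSFactorisation (sym w≡x++u)
            (lpsFactorisation-++ (go x (smaller |x|<|w|) x-rich) u≢[] u∉x
                                 (subst (IsLongestPalSuffix u) w≡x++u u-lps))
      where
      u-lps : IsLongestPalSuffix u (v ∷ʳ b)
      u-lps = (x , w≡x++u) , u-pal , u-max
      u≢[] : NonEmpty u
      u≢[] refl with () ← u-max [ b ] (v , refl) refl
      v-split : ∃[ z ] (v ≡ x ++ z)
      v-split = prefix-of-init x u≢[] (sym w≡x++u)
      u∉x : ¬ IsFactor u x
      u∉x u∈x with z , v≡x++z ← v-split =
        lps-unioccurrent rich u-lps (subst (IsFactor u) (sym v≡x++z) (factor-++ʳ z u∈x))
      |x|<|w| : length x < length (v ∷ʳ b)
      |x|<|w| with z , v≡x++z ← v-split =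
        subst (length x <_) (sym (length-∷ʳ v b))
              (s≤s (subst (λ z → length x ≤ length z) (sym v≡x++z) (length-++-≤ˡ x)))
      x-rich : AtLeastRich x
      x-rich = atLeastRich-++⁻ x u (subst AtLeastRich w≡x++u rich)

module _ {a b} {A : Set a} {B : Set b} (g : B → A) where

  map-≡-++ : ∀ (c : List B) x z → map g c ≡ x ++ z →
             ∃[ x′ ] ∃[ z′ ] (c ≡ x′ ++ z′ × x ≡ map g x′ × z ≡ map g z′)
  map-≡-++ c       []      z e = [] , c , refl , refl , sym e
  map-≡-++ []      (_ ∷ _) _ ()
  map-≡-++ (d ∷ c) (_ ∷ x) z e with refl , e′ ← ∷-injective e
    with x′ , z′ , c≡x′++z′ , x≡ , z≡ ← map-≡-++ c x z e′ =
    d ∷ x′ , z′ , cong (d ∷_) c≡x′++z′ , cong (g d ∷_) x≡ , z≡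

  factor-map⁻ : ∀ {c u} → IsFactor u (map g c) → ∃[ u′ ] (u ≡ map g u′ × IsFactor u′ c)
  factor-map⁻ {c} {u} (x , y , e)
    with x′ , z′ , c≡x′++z′ , _ , z≡ ← map-≡-++ c x (u ++ y) e
    with u′ , y′ , z′≡u′++y′ , u≡ , _ ← map-≡-++ z′ u y (sym z≡) =
    u′ , u≡ , x′ , y′ , trans c≡x′++z′ (cong (x′ ++_) z′≡u′++y′)

  palindrome-map⁺ : ∀ {u} → IsPalindrome u → IsPalindrome (map g u)
  palindrome-map⁺ {u} u-pal = trans (cong (map g) u-pal) (reverse-map g u)

  concat-reverse-map : ∀ ws → concat (reverse (map (map g) ws)) ≡ map g (concat (reverse ws))
  concat-reverse-map ws = trans (cong concat (sym (reverse-map (map g) ws))) (concat-map (reverse ws))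

  module _ (g-injective : Injective _≡_ _≡_ g) where

    palindrome-map⁻ : ∀ {u} → IsPalindrome (map g u) → IsPalindrome u
    palindrome-map⁻ {u} gu-pal = map-injective g-injective (trans gu-pal (sym (reverse-map g u)))

    palFactors-map⁻ : ∀ {c} ps → All (PalFactor (map g c)) ps →
                      ∃[ qs ] (All (PalFactor c) qs × map (map g) qs ≡ ps)
    palFactors-map⁻ []       []                  = [] , [] , refl
    palFactors-map⁻ (p ∷ ps) ((p-fac , p-pal) ∷ pps)
      with u′ , refl , u′-fac ← factor-map⁻ p-fac | qs , pqs , refl ← palFactors-map⁻ ps pps =
      u′ ∷ qs , (u′-fac , palindrome-map⁻ p-pal) ∷ pqs , refl

    rich-map⁻ : ∀ {c} → Rich (map g c) → AtLeastRich c
    rich-map⁻ {c} (ps , ps-unique , pps , _ , |ps|≡) with qs , pqs , refl ← palFactors-map⁻ ps pps =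
      qs , Unique.map⁻ ps-unique , pqs ,
      ≤-reflexive (trans (cong suc (sym (length-map g c))) (trans (sym |ps|≡) (length-map (map g) qs)))

    longestPalSuffix-map⁺ : ∀ {u w} → IsLongestPalSuffix u w → IsLongestPalSuffix (map g u) (map g w)
    longestPalSuffix-map⁺ {u} {w} ((x , w≡x++u) , u-pal , u-max) =
      (map g x , trans (cong (map g) w≡x++u) (map-++ g x u)) , palindrome-map⁺ u-pal , gu-max
      where
      gu-max : ∀ t → IsSuffix t (map g w) → IsPalindrome t → length t ≤ length (map g u)
      gu-max t (y , e) t-pal with y′ , t′ , w≡y′++t′ , _ , refl ← map-≡-++ w y t e =
        subst₂ _≤_ (sym (length-map g t′)) (sym (length-map g u))
               (u-max t′ (y′ , w≡y′++t′) (palindrome-map⁻ t-pal))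

    lpsChain-map⁺ : ∀ {ws} → LPSChain ws → LPSChain (map (map g) ws)
    lpsChain-map⁺ []                     = []
    lpsChain-map⁺ {u ∷ us} (u-lps ∷ chain) =
      subst (IsLongestPalSuffix (map g u)) (sym (concat-reverse-map (u ∷ us)))
            (longestPalSuffix-map⁺ u-lps)
      ∷ lpsChain-map⁺ chain

    lpsFactorisation-map⁺ : ∀ {c} → LPSFactorisation c → LPSFactorisation (map g c)
    lpsFactorisation-map⁺ (ws , ws-unique , ws-nonEmpty , ws-pal , refl , chain) =
      map (map g) ws , Unique.map⁺ (map-injective g-injective) ws-unique ,
      All.map⁺ (All.map nonEmpty-map⁺ ws-nonEmpty) , All.map⁺ (All.map palindrome-map⁺ ws-pal) ,
      sym (concat-reverse-map ws) , lpsChain-map⁺ chain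
      where
      nonEmpty-map⁺ : ∀ {u} → NonEmpty u → NonEmpty (map g u)
      nonEmpty-map⁺ {[]}    u≢[] = ⊥-elim (u≢[] refl)
      nonEmpty-map⁺ {_ ∷ _} _    ()

module _ {a} {A : Set a} {ps : List (List A)} (ps-unique : Unique ps) where

  Letter : Set a
  Letter = Σ A (λ x → [ x ] ∈ ps)

  letter-injective : Injective _≡_ _≡_ (proj₁ {B = λ x → [ x ] ∈ ps})
  letter-injective {x , m} {.x , m′} refl = cong (x ,_) (unique⇒irrelevant ps-unique m m′)

  _≟ˡ_ : DecidableEquality Letter
  (x , m) ≟ˡ (y , m′) with index m ≟ᶠ index m′
  ... | yes i≡j = yes (letter-injective (∷-injectiveˡ
                    (trans (lookup-index m) (trans (cong (lookup ps) i≡j) (sym (lookup-index m′))))))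
  ... | no  i≢j = no λ { refl → i≢j refl }

map-proj₁-toList : ∀ {a p} {A : Set a} {P : A → Set p} {xs} (pxs : All P xs) →
                   map proj₁ (All.toList pxs) ≡ xs
map-proj₁-toList []         = refl
map-proj₁-toList (_ ∷ pxs) = cong (_ ∷_) (map-proj₁-toList pxs)

lemma1 : ∀ {a} {A : Set a} (w : List A) → Rich w →
    ∃[ ws ] (Unique ws × All NonEmpty ws × All IsPalindrome ws
             × w ≡ concat (reverse ws) × LPSChain ws)
lemma1 w rich@(ps , ps-unique , _ , covers , _) =
  subst LPSFactorisation (map-proj₁-toList letters)
        (lpsFactorisation-map⁺ proj₁ injective (lpsFactorisation (_≟ˡ_ ps-unique) code code-rich))
  where
  letters : All (λ x → [ x ] ∈ ps) w
  letters = All.tabulate (λ x∈w → covers _ (∈-∃++ x∈w , refl))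
  code : List (Letter ps-unique)
  code = All.toList letters
  injective : Injective _≡_ _≡_ (proj₁ {B = λ x → [ x ] ∈ ps})
  injective = letter-injective ps-unique
  code-rich : AtLeastRich code
  code-rich = rich-map⁻ proj₁ injective (subst Rich (sym (map-proj₁-toList letters)) rich)
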